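{- Let $\Pi$ be a Natural Deduction proof of $\alpha$ in $M_{\supset}$, and let $G(\Pi)$ be defined recursively by: $G(\Pi)=\alpha$ if $\Pi$ is the one-node derivation $\alpha$; if $\Pi$ ends with a $\supset$-introduction concluding $\beta_1\supset\beta_2$ from a subderivation $\Pi'$, then $G(\Pi)$ is $G(\Pi')$ followed by a greedy $\supset$-introduction concluding $\beta_1\supset\beta_2$; if $\Pi$ ends with a $\supset$-elimination concluding $\beta$ from subderivations $\Pi_1,\Pi_2$, then $G(\Pi)$ is $G(\Pi_1)$ and $G(\Pi_2)$ followed by that $\supset$-elimination. Then $G(\Pi)$ is also a valid proof of $\alpha$ in $M_{\supset}$.
   Context: $M_{\supset}$ is the purely implicational fragment of propositional minimal logic, with Natural Deduction rules $\supset$-introduction (from $\beta$ infer $\alpha\supset\beta$, discharging occurrences of the assumption $\alpha$) and $\supset$-elimination (from $\alpha$ and $\alpha\supset\beta$ infer $\beta$). A proof is a derivation with no open (undischarged) assumptions. An application of $\supset$-introduction concluding $\alpha\supset\beta$ from the premiss $\beta$ is greedy if it discharges every open occurrence of $\alpha$ among the assumptions on which that premiss $\beta$ depends (i.e. every open occurrence of $\alpha$ in the subderivation of $\beta$). -}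

module Defs where

open import Data.Nat using (ℕ; zero; suc; _<_; _≤ᵇ_)
import Data.Nat as ℕ
open import Data.Bool using (Bool; true; false; _∧_; if_then_else_)
open import Data.List using (List; []; _∷_)
open import Data.Maybe using (Maybe; just; nothing)
open import Data.Product using (_×_)
open import Relation.Binary.PropositionalEquality using (_≡_)

infixr 20 _⊃_
data Formula : Set where
  atom : ℕ → Formula
  _⊃_  : Formula → Formula → Formula

_==F_ : Formula → Formula → Bool
atom m  ==F atom n  = m ℕ.≡ᵇ n
(A ⊃ B) ==F (C ⊃ D) = (A ==F C) ∧ (B ==F D)
_       ==F _       = false

-- * hyp A k : an assumption occurrence of A.  The discharge information is
--   a de Bruijn index k, counting ⊃I-nodes on the path from the leaf
--   towards the root: if k < (number of enclosing ⊃I nodes) the occurrence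
--   is discharged by the k-th enclosing ⊃I (0 = innermost); otherwise the
--   occurrence is open (undischarged).
-- * ⊃I A B d : ⊃-introduction concluding A ⊃ B from the premiss-derivation d
--   (it discharges exactly the leaves of d whose index points to it).
-- * ⊃E B d₁ d₂ : ⊃-elimination concluding B from d₁ (of some α) and
--   d₂ (of α ⊃ B).

data Deriv : Set where
  hyp : Formula → ℕ → Deriv
  ⊃I  : Formula → Formula → Deriv → Deriv
  ⊃E  : Formula → Deriv → Deriv → Deriv

concl : Deriv → Formula
concl (hyp A _)    = A
concl (⊃I A B _)   = A ⊃ B
concl (⊃E B _ _)   = B

_‼_ : {X : Set} → List X → ℕ → Maybe X
[]       ‼ _     = nothing
(x ∷ xs) ‼ zero  = just x
(x ∷ xs) ‼ suc k = xs ‼ k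

-- Correctness of rule applications.  Γ lists the antecedents of the
-- enclosing ⊃I nodes (innermost first).
Valid : List Formula → Deriv → Set
Valid Γ (hyp A k)    = ∀ B → Γ ‼ k ≡ just B → B ≡ A
Valid Γ (⊃I A B d)   = Valid (A ∷ Γ) d × concl d ≡ B
Valid Γ (⊃E B d₁ d₂) = Valid Γ d₁ × Valid Γ d₂ × concl d₂ ≡ (concl d₁ ⊃ B)

NoOpen : ℕ → Deriv → Set
NoOpen δ (hyp A k)    = k < δ
NoOpen δ (⊃I A B d)   = NoOpen (suc δ) d
NoOpen δ (⊃E B d₁ d₂) = NoOpen δ d₁ × NoOpen δ d₂

IsProof : Deriv → Formula → Set
IsProof d α = Valid [] d × concl d ≡ α × NoOpen 0 d

-- bindAll A δ d redirects every occurrence of A that is open in d (index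
-- ≥ δ at depth δ) to the ⊃I node sitting directly above d (index = depth).
bindAll : Formula → ℕ → Deriv → Deriv
bindAll A δ (hyp C k)    = if (C ==F A) ∧ (δ ≤ᵇ k) then hyp C δ else hyp C k
bindAll A δ (⊃I C D d)   = ⊃I C D (bindAll A (suc δ) d)
bindAll A δ (⊃E B d₁ d₂) = ⊃E B (bindAll A δ d₁) (bindAll A δ d₂)

greedy⊃I : Formula → Formula → Deriv → Deriv
greedy⊃I A B d = ⊃I A B (bindAll A 0 d)

G : Deriv → Deriv
G (hyp A k)    = hyp A k
G (⊃I A B d)   = greedy⊃I A B (G d)
G (⊃E B d₁ d₂) = ⊃E B (G d₁) (G d₂)

{-# OPTIONS --safe #-}
module Submission where

-- A greedy ⊃I only rebinds open occurrences of its own antecedent A to itself,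
-- so every rebound leaf still carries the formula recorded for its binder
-- (validity), and the new index points into the enclosing context (closedness).
-- G performs such rebindings bottom-up without changing any conclusion.

open import Defs
open import Data.Nat using (suc; _<_; _≤ᵇ_; s≤s; z≤n)
open import Data.Nat.Properties using (≡ᵇ⇒≡)
open import Data.Bool using (true; false; T; _∧_)
open import Data.Bool.Properties using (T-∧; T-≡)
open import Data.Maybe using (just)
open import Data.Maybe.Properties using (just-injective)
open import Data.Product using (_,_; proj₁)
open import Function.Bundles using (Equivalence)
open import Relation.Binary.PropositionalEquality
  using (_≡_; refl; sym; trans; cong; cong₂; module ≡-Reasoning)

open Equivalence using (to; from)

==F⇒≡ : ∀ A B → T (A ==F B) → A ≡ B
==F⇒≡ (atom m)  (atom n)  t = cong atom (≡ᵇ⇒≡ m n t)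
==F⇒≡ (A ⊃ B) (C ⊃ D) t =
  let tA , tB = T-∧ .to t in cong₂ _⊃_ (==F⇒≡ A C tA) (==F⇒≡ B D tB)

⊃E-concl-transport : ∀ {B α α′ β β′ : Formula} →
  α′ ≡ α → β′ ≡ β → β ≡ α ⊃ B → β′ ≡ α′ ⊃ B
⊃E-concl-transport {B} {α} {α′} {β} {β′} α′≡α β′≡β β≡α⊃B = begin
  β′       ≡⟨ β′≡β ⟩
  β        ≡⟨ β≡α⊃B ⟩
  α ⊃ B    ≡⟨ cong (_⊃ B) (sym α′≡α) ⟩
  α′ ⊃ B   ∎
  where open ≡-Reasoning

concl-bindAll : ∀ A δ d → concl (bindAll A δ d) ≡ concl d
concl-bindAll A δ (hyp C k) with (C ==F A) ∧ (δ ≤ᵇ k)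
... | true  = refl
... | false = refl
concl-bindAll A δ (⊃I _ _ _)   = refl
concl-bindAll A δ (⊃E _ _ _)   = refl

concl-G : ∀ d → concl (G d) ≡ concl d
concl-G (hyp _ _)    = refl
concl-G (⊃I _ _ _)   = refl
concl-G (⊃E _ _ _)   = refl

bindAll-preserves-Valid : ∀ {Γ} A δ d → Γ ‼ δ ≡ just A →
  Valid Γ d → Valid Γ (bindAll A δ d)
bindAll-preserves-Valid A δ (hyp C k) Γ‼δ≡A v
  with (C ==F A) ∧ (δ ≤ᵇ k) in rebind
... | false = v
... | true  = λ B Γ‼δ≡B → trans (just-injective (trans (sym Γ‼δ≡B) Γ‼δ≡A)) (sym C≡A)
  where
  C≡A : C ≡ A
  C≡A = ==F⇒≡ C A (proj₁ (T-∧ .to (T-≡ .from rebind)))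
bindAll-preserves-Valid A δ (⊃I C D d) Γ‼δ≡A (v , c) =
  bindAll-preserves-Valid A (suc δ) d Γ‼δ≡A v , trans (concl-bindAll A (suc δ) d) c
bindAll-preserves-Valid A δ (⊃E B d₁ d₂) Γ‼δ≡A (v₁ , v₂ , c) =
  bindAll-preserves-Valid A δ d₁ Γ‼δ≡A v₁ ,
  bindAll-preserves-Valid A δ d₂ Γ‼δ≡A v₂ ,
  ⊃E-concl-transport (concl-bindAll A δ d₁) (concl-bindAll A δ d₂) c

bindAll-preserves-NoOpen : ∀ A {δ n} d → δ < n → NoOpen n d → NoOpen n (bindAll A δ d)
bindAll-preserves-NoOpen A {δ} (hyp C k) δ<n k<n with (C ==F A) ∧ (δ ≤ᵇ k)
... | true  = δ<n
... | false = k<n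
bindAll-preserves-NoOpen A (⊃I C D d) δ<n no = bindAll-preserves-NoOpen A d (s≤s δ<n) no
bindAll-preserves-NoOpen A (⊃E B d₁ d₂) δ<n (no₁ , no₂) =
  bindAll-preserves-NoOpen A d₁ δ<n no₁ , bindAll-preserves-NoOpen A d₂ δ<n no₂

G-preserves-Valid : ∀ {Γ} d → Valid Γ d → Valid Γ (G d)
G-preserves-Valid (hyp A k) v = v
G-preserves-Valid (⊃I A B d) (v , c) =
  bindAll-preserves-Valid A 0 (G d) refl (G-preserves-Valid d v) ,
  trans (concl-bindAll A 0 (G d)) (trans (concl-G d) c)
G-preserves-Valid (⊃E B d₁ d₂) (v₁ , v₂ , c) =
  G-preserves-Valid d₁ v₁ , G-preserves-Valid d₂ v₂ ,
  ⊃E-concl-transport (concl-G d₁) (concl-G d₂) c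

G-preserves-NoOpen : ∀ {n} d → NoOpen n d → NoOpen n (G d)
G-preserves-NoOpen (hyp A k) no = no
G-preserves-NoOpen (⊃I A B d) no =
  bindAll-preserves-NoOpen A (G d) (s≤s z≤n) (G-preserves-NoOpen d no)
G-preserves-NoOpen (⊃E B d₁ d₂) (no₁ , no₂) =
  G-preserves-NoOpen d₁ no₁ , G-preserves-NoOpen d₂ no₂

lemma1 : (Π : Deriv) (α : Formula) → IsProof Π α → IsProof (G Π) α
lemma1 Π α (valid , concl≡α , closed) =
  G-preserves-Valid Π valid , trans (concl-G Π) concl≡α , G-preserves-NoOpen Π closed
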